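{- Let $G=\langle x\rangle$ be a finite cyclic group. (i) If $o(x)$ is a prime power, then $\mathcal U(G)=\{G\}$. (ii) If $o(x)$ is not a prime power, then $\mathcal U(G)=(\mathcal C'(G)\setminus\{[e],[x]\})\cup\{[e]\cup[x]\}$.
   Context: $e$ is the identity of $G$ and $o(y)$ the order of $y$. $\mathcal P_G$ is the power graph (vertex set $G$, distinct elements adjacent iff one is a power of the other); $N(y)$ is the set of neighbours of $y$ in $\mathcal P_G$ and $N[y]=N(y)\cup\{y\}$. Define $y\equiv z$ iff $N(y)=N(z)$ or $N[y]=N[z]$ (an equivalence relation), and let $\mathcal U(G)$ be the set of its equivalence classes. For $y\in G$, $[y]$ is the set of generators of $\langle y\rangle$, and $\mathcal C'(G)=\{[y]:y\in G\}$. -}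

module Defs where

open import Level using (Level; _⊔_)
open import Data.Nat using (ℕ; zero; suc; _≤_; _<_; _^_)
open import Data.Nat.Primality using (Prime)
open import Data.Product using (Σ; ∃; _×_; _,_)
open import Data.Sum using (_⊎_)
open import Data.List using (List)
open import Relation.Nullary using (¬_)
open import Relation.Binary.PropositionalEquality using (_≡_)
open import Algebra.Bundles using (Group)
import Data.List.Membership.Setoid as SetoidMembership

module PowerGraph {c ℓ : Level} (G : Group c ℓ) where
  open Group G

  Elem : Set c
  Elem = Carrier

  e : Carrier
  e = ε

  -- natural-number powers  y ^ k  (integer powers give the same sets in a finite group)
  pow : Carrier → ℕ → Carrier
  pow y zero    = ε
  pow y (suc k) = y ∙ pow y k

  IsPowerOf : Carrier → Carrier → Set ℓ
  IsPowerOf y z = ∃ λ k → y ≈ pow z k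

  Adj : Carrier → Carrier → Set ℓ
  Adj y z = (¬ (y ≈ z)) × (IsPowerOf y z ⊎ IsPowerOf z y)

  Subset : Set (Level.suc (c ⊔ ℓ))
  Subset = Carrier → Set (c ⊔ ℓ)

  _≐_ : {a b : Level} → (Carrier → Set a) → (Carrier → Set b) → Set (c ⊔ a ⊔ b)
  S ≐ T = ∀ w → (S w → T w) × (T w → S w)

  _∪_ : (Carrier → Set ℓ) → (Carrier → Set ℓ) → (Carrier → Set ℓ)
  (S ∪ T) w = S w ⊎ T w

  N : Carrier → Carrier → Set ℓ
  N y = Adj y

  N[_] : Carrier → Carrier → Set ℓ
  N[ y ] w = Adj y w ⊎ (w ≈ y)

  _≡N_ : Carrier → Carrier → Set (c ⊔ ℓ)
  y ≡N z = (N y ≐ N z) ⊎ (N[ y ] ≐ N[ z ])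

  -- S is an equivalence class of ≡N  (i.e. S ∈ 𝒰(G))
  IsClass : Subset → Set (c ⊔ ℓ)
  IsClass S = Σ Carrier λ y → S ≐ (λ z → z ≡N y)

  -- [y] : the set of generators of ⟨y⟩
  gens : Carrier → Carrier → Set ℓ
  gens y z = IsPowerOf z y × IsPowerOf y z

  InC' : Subset → Set (c ⊔ ℓ)
  InC' S = Σ Carrier λ y → S ≐ gens y

  Whole : Carrier → Set ℓ
  Whole _ = Level.Lift ℓ Data.Unit.⊤
    where import Data.Unit

  Finite : Set (c ⊔ ℓ)
  Finite = Σ (List Carrier) λ xs → ∀ g → g ∈ xs
    where open SetoidMembership setoid using (_∈_)

  Generates : Carrier → Set (c ⊔ ℓ)
  Generates x = ∀ g → IsPowerOf g x

  IsOrder : Carrier → ℕ → Set ℓ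
  IsOrder x n = (0 < n) × (pow x n ≈ ε) × (∀ m → 0 < m → pow x m ≈ ε → n ≤ m)

IsPrimePower : ℕ → Set
IsPrimePower n = ∃ λ p → ∃ λ k → Prime p × n ≡ p ^ k

-- Write u ≈ xᵃ and let index u = gcd a n, so that ⟨u⟩ = ⟨x ^ index u⟩. Then u is a power of v
-- iff index v ∣ index u, so the closed neighbourhood N[u] consists of the elements whose index
-- is comparable with index u under divisibility, and [u] of those with the same index.
-- If n is a prime power its divisors form a chain, every N[u] is G and there is a single class.
-- Otherwise N[u] = G exactly when index u ∈ {1, n}, i.e. u ∈ [e] ∪ [x]: if p is a prime dividing
-- d ∉ {1, n} and n = pʲ m with p ∤ m, then m or pʲ is incomparable with d. For the remaining
-- elements N[w] = N[y] forces index w = index y, because two divisors a ∣ b of n with the same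
-- comparable divisors coincide (test a divisor f against gcd b f and lcm a f). Equal open
-- neighbourhoods N(w) = N(y) force w ≈ y: y⁻¹ ∈ N(y) unless y² = e, and the elements with
-- y² = e have index n or n/2.

module Submission where

open import Level using (Level; _⊔_; lift)
open import Data.Unit.Base using (tt)
open import Data.Nat using (ℕ)
open import Data.Nat.Base hiding (_⊔_)
open import Data.Nat.Properties
  using (*-comm; *-zeroʳ; +-identityʳ; ≤-total; ≤-<-trans; <⇒≱; m≤n+m; m≤n⇒∃[o]m+o≡n; suc-pred; _≟_)
open import Data.Nat.Divisibility
open import Data.Nat.DivMod
open import Data.Nat.GCD
open import Data.Product using (Σ; _×_; _,_; proj₁; proj₂; swap; uncurry)
open import Data.Sum as Sum using (_⊎_; inj₁; inj₂)
open import Function.Base using (_∘_)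
open import Function.Bundles using (_⇔_; mk⇔; Equivalence)
open import Function.Properties.Equivalence using () renaming (trans to ⇔-trans; sym to ⇔-sym)
open import Relation.Nullary using (¬_; Dec; yes; no; contradiction)
open import Relation.Nullary.Decidable using (map′; _⊎-dec_)
import Relation.Binary.PropositionalEquality as ≡
open ≡ using (_≡_; _≢_)
open import Algebra.Bundles using (Group)
open import Defs

open Equivalence using (to; from)

module Arithmetic where
  open import Data.Nat.Properties
  open import Data.Nat.LCM
  open import Data.Nat.Coprimality as Coprime using (Coprime; coprime-divisor)
  open import Data.Nat.Primality using (Prime; prime[2]; prime⇒irreducible; prime⇒nonTrivial)
  open import Data.Nat.Primality.Factorisation using (factorise)
  open import Data.Nat.ListAction using (product)
  open import Data.List.Base using ([]; _∷_)
  open import Data.List.Relation.Unary.All using (_∷_)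
  open import Data.Product using (∃-syntax; ∃₂)
  open import Data.Nat.Induction using (<-wellFounded)
  open import Induction.WellFounded using (Acc; acc)
  open import Relation.Binary.PropositionalEquality

  private variable a b d f g m n p : ℕ

  Comparable : ℕ → ℕ → Set
  Comparable a b = a ∣ b ⊎ b ∣ a

  ∣-nonZero : .{{NonZero n}} → d ∣ n → NonZero d
  ∣-nonZero {n} {zero} 0∣n = contradiction (0∣⇒≡0 0∣n) (≢-nonZero⁻¹ n)
  ∣-nonZero {d = suc _} _ = _

  ∣⇒gcd≡ : d ∣ n → gcd d n ≡ d
  ∣⇒gcd≡ {d} {n} d∣n = ∣-antisym (gcd[m,n]∣m d n) (gcd-greatest ∣-refl d∣n)

  ∃prime∣ : ∀ d .{{_ : NonZero d}} → d ≢ 1 → ∃[ p ] Prime p × p ∣ d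
  ∃prime∣ d d≢1 with factorise d
  ... | record { factors = [] ; isFactorisation = d≡1 } = contradiction d≡1 d≢1
  ... | record { factors = p ∷ ps ; isFactorisation = d≡p*ps ; factorsPrime = pp ∷ _ } =
    p , pp , divides (product ps) (trans d≡p*ps (*-comm p (product ps)))

  prime∤⇒coprime : Prime p → ¬ p ∣ m → Coprime p m
  prime∤⇒coprime pp p∤m (i∣p , i∣m) with prime⇒irreducible pp i∣p
  ... | inj₁ i≡1 = i≡1
  ... | inj₂ refl = contradiction i∣m p∤m

  ∣prime^⇒≡1 : Prime p → ¬ p ∣ d → ∀ k → d ∣ p ^ k → d ≡ 1
  ∣prime^⇒≡1 pp p∤d zero d∣1 = ∣1⇒≡1 d∣1
  ∣prime^⇒≡1 pp p∤d (suc k) d∣pᵏ⁺¹ =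
    ∣prime^⇒≡1 pp p∤d k (coprime-divisor (Coprime.sym (prime∤⇒coprime pp p∤d)) d∣pᵏ⁺¹)

  prime^-coprime : Prime p → ¬ p ∣ m → ∀ k → Coprime (p ^ k) m
  prime^-coprime pp p∤m k (i∣pᵏ , i∣m) =
    ∣prime^⇒≡1 pp (λ p∣i → p∤m (∣-trans p∣i i∣m)) k i∣pᵏ

  coprime⇒*∣ : Coprime m f → m ∣ d → f ∣ d → m * f ∣ d
  coprime⇒*∣ {m} {f} coprime (divides q refl) f∣qm =
    subst (m * f ∣_) (*-comm m q)
      (*-monoʳ-∣ m (coprime-divisor (Coprime.sym coprime) (subst (f ∣_) (*-comm q m) f∣qm)))

  prime-power-split : Prime p → ∀ n .{{_ : NonZero n}} → ∃₂ λ j m → n ≡ p ^ j * m × ¬ p ∣ m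
  prime-power-split {p} pp n = split n (<-wellFounded n)
    where
    instance
      _ : NonTrivial p
      _ = prime⇒nonTrivial pp

    split : ∀ n .{{_ : NonZero n}} → Acc _<_ n → ∃₂ λ j m → n ≡ p ^ j * m × ¬ p ∣ m
    split n _ with p ∣? n
    split n _ | no p∤n = 0 , n , sym (+-identityʳ n) , p∤n
    split n (acc rec) | yes p∣n with split (quotient p∣n) {{quotient≢0 p∣n}} (rec (quotient-< p∣n))
    ... | j , m , q≡pʲm , p∤m = suc j , m , n≡pʲ⁺¹m , p∤m
      where
      open ≡-Reasoning
      n≡pʲ⁺¹m : n ≡ p ^ suc j * m
      n≡pʲ⁺¹m = begin
        n                  ≡⟨ m∣n⇒n≡m*quotient p∣n ⟩
        p * quotient p∣n   ≡⟨ cong (p *_) q≡pʲm ⟩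
        p * (p ^ j * m)    ≡⟨ *-assoc p (p ^ j) m ⟨
        p ^ suc j * m      ∎

  prime^-divisors-comparable : Prime p → ∀ k → a ∣ p ^ k → b ∣ p ^ k → Comparable a b
  prime^-divisors-comparable {p} {a} {b} pp k a∣pᵏ b∣pᵏ with p ∣? a | p ∣? b
  ... | no p∤a | _ = inj₁ (subst (_∣ b) (sym (∣prime^⇒≡1 pp p∤a k a∣pᵏ)) (1∣ b))
  ... | yes _ | no p∤b = inj₂ (subst (_∣ a) (sym (∣prime^⇒≡1 pp p∤b k b∣pᵏ)) (1∣ a))
  ... | yes (divides a′ refl) | yes (divides b′ refl) =
    Sum.map (*-monoˡ-∣ p) (*-monoˡ-∣ p) (quotients-comparable k a∣pᵏ b∣pᵏ)
    where
    instance
      _ : NonTrivial p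
      _ = prime⇒nonTrivial pp

      _ : NonZero p
      _ = nonTrivial⇒nonZero p

    quotients-comparable : ∀ k → a′ * p ∣ p ^ k → b′ * p ∣ p ^ k → Comparable a′ b′
    quotients-comparable zero a′p∣1 _ =
      contradiction (∣1⇒≡1 (∣-trans (n∣m*n a′) a′p∣1)) (nonTrivial⇒≢1 {p})
    quotients-comparable (suc k) a′p∣pᵏ⁺¹ b′p∣pᵏ⁺¹ =
      prime^-divisors-comparable pp k (cancel a′p∣pᵏ⁺¹) (cancel b′p∣pᵏ⁺¹)
      where
      cancel : ∀ {c} → c * p ∣ p * p ^ k → c ∣ p ^ k
      cancel {c} c*p∣ = *-cancelʳ-∣ p (subst (c * p ∣_) (*-comm p (p ^ k)) c*p∣)

  nonPrimePower⇒incomparable : .{{NonZero n}} → ¬ IsPrimePower n →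
    d ∣ n → d ≢ 1 → d ≢ n → ¬ (∀ e → e ∣ n → Comparable d e)
  nonPrimePower⇒incomparable {n} {d} ¬ppow d∣n d≢1 d≢n comparable
    with ∃prime∣ d {{∣-nonZero d∣n}} d≢1
  ... | p , pp , p∣d with prime-power-split pp n
  ... | j , m , n≡pʲm , p∤m with m ≟ 1
  ... | yes refl = ¬ppow (p , j , pp , trans n≡pʲm (*-identityʳ (p ^ j)))
  ... | no m≢1 with comparable m (divides (p ^ j) n≡pʲm)
                  | comparable (p ^ j) (divides m (trans n≡pʲm (*-comm (p ^ j) m)))
  ... | inj₁ d∣m | _ = p∤m (∣-trans p∣d d∣m)
  ... | inj₂ m∣d | inj₁ d∣pʲ = m≢1 (∣prime^⇒≡1 pp p∤m j (∣-trans m∣d d∣pʲ))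
  ... | inj₂ m∣d | inj₂ pʲ∣d =
    d≢n (∣-antisym d∣n
      (subst (_∣ d) (sym n≡pʲm) (coprime⇒*∣ (prime^-coprime pp p∤m j) pʲ∣d m∣d)))

  gcd∣∧∣lcm⇒≡ : .{{NonZero f}} → a ∣ b → gcd b f ∣ a → b ∣ lcm a f → a ≡ b
  gcd∣∧∣lcm⇒≡ {f} {a} {b} a∣b gcd∣a b∣lcm = *-cancelʳ-≡ a b f (begin
    a * f                ≡⟨ gcd*lcm a f ⟨
    gcd a f * lcm a f    ≡⟨ cong₂ _*_ gcd-equal lcm-equal ⟩
    gcd b f * lcm b f    ≡⟨ gcd*lcm b f ⟩
    b * f                ∎)
    where
    open ≡-Reasoning
    gcd-equal : gcd a f ≡ gcd b f
    gcd-equal = ∣-antisym (gcd-greatest (∣-trans (gcd[m,n]∣m a f) a∣b) (gcd[m,n]∣n a f))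
                          (gcd-greatest gcd∣a (gcd[m,n]∣n b f))
    lcm-equal : lcm a f ≡ lcm b f
    lcm-equal = ∣-antisym (lcm-least (∣-trans a∣b (m∣lcm[m,n] b f)) (n∣lcm[m,n] b f))
                          (lcm-least b∣lcm (n∣lcm[m,n] a f))

  sameComparables⇒≡ : .{{NonZero n}} → ¬ IsPrimePower n →
    a ∣ n → b ∣ n → a ∣ b → b ≢ 1 → b ≢ n →
    (∀ e → e ∣ n → Comparable e a ⇔ Comparable e b) → a ≡ b
  sameComparables⇒≡ {n} {a} {b} ¬ppow a∣n b∣n a∣b b≢1 b≢n same with a ≟ b
  ... | yes a≡b = a≡b
  ... | no a≢b = contradiction comparable (nonPrimePower⇒incomparable ¬ppow b∣n b≢1 b≢n)
    where
    comparable : ∀ f → f ∣ n → Comparable b f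
    comparable f f∣n
      with from (same (gcd b f) (∣-trans (gcd[m,n]∣n b f) f∣n)) (inj₁ (gcd[m,n]∣m b f))
         | to (same (lcm a f) (lcm-least a∣n f∣n)) (inj₂ (m∣lcm[m,n] a f))
    ... | _ | inj₁ lcm∣b = inj₂ (∣-trans (n∣lcm[m,n] a f) lcm∣b)
    ... | inj₂ a∣gcd | inj₂ b∣lcm =
      inj₁ (∣-trans b∣lcm (lcm-least (∣-trans a∣gcd (gcd[m,n]∣n b f)) ∣-refl))
    ... | inj₁ gcd∣a | inj₂ b∣lcm =
      contradiction (gcd∣∧∣lcm⇒≡ {{∣-nonZero f∣n}} a∣b gcd∣a b∣lcm) a≢b

  ∣∧∣2*⇒≡∨2*≡ : .{{NonZero n}} → g ∣ n → n ∣ 2 * g → g ≡ n ⊎ 2 * g ≡ n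
  ∣∧∣2*⇒≡∨2*≡ {n} {g} g∣n@(divides t n≡tg) n∣2g with prime⇒irreducible prime[2] t∣2
    where
    instance
      _ : NonZero g
      _ = ∣-nonZero g∣n
    t∣2 : t ∣ 2
    t∣2 = *-cancelʳ-∣ g (subst (_∣ 2 * g) n≡tg n∣2g)
  ... | inj₁ refl = inj₁ (sym (trans n≡tg (*-identityˡ g)))
  ... | inj₂ refl = inj₂ (sym n≡tg)

  ≡∨2*≡⇒comparable : a ≡ n ⊎ 2 * a ≡ n → b ≡ n ⊎ 2 * b ≡ n →
    a ∣ n → b ∣ n → Comparable a b
  ≡∨2*≡⇒comparable (inj₁ refl) _ _ b∣a = inj₂ b∣a
  ≡∨2*≡⇒comparable (inj₂ _) (inj₁ refl) a∣b _ = inj₁ a∣b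
  ≡∨2*≡⇒comparable {a} {n} {b} (inj₂ 2a≡n) (inj₂ 2b≡n) _ _ =
    inj₁ (∣-reflexive (*-cancelˡ-≡ a b 2 (trans 2a≡n (sym 2b≡n))))

open Arithmetic

module PowerGraphProperties {c ℓ : Level} (G : Group c ℓ) where
  open Group G
  open PowerGraph G
  open import Algebra.Properties.Monoid.Mult monoid using (×-congʳ; ×-congˡ; ×-homo-+; ×-assocˡ)
    renaming (_×_ to _·_)
  open import Algebra.Properties.Group G using (inverseʳ-unique)

  pow≡× : ∀ u k → pow u k ≡ k · u
  pow≡× u zero = ≡.refl
  pow≡× u (suc k) = ≡.cong (u ∙_) (pow≡× u k)

  pow-cong : ∀ k {u v} → u ≈ v → pow u k ≈ pow v k
  pow-cong k {u} {v} u≈v rewrite pow≡× u k | pow≡× v k = ×-congʳ k u≈v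

  pow-+ : ∀ u a b → pow u (a + b) ≈ pow u a ∙ pow u b
  pow-+ u a b rewrite pow≡× u (a + b) | pow≡× u a | pow≡× u b = ×-homo-+ u a b

  pow-* : ∀ u a b → pow u (a * b) ≈ pow (pow u a) b
  pow-* u a b rewrite pow≡× u (a * b) | pow≡× u a | pow≡× (a · u) b =
    sym (trans (×-assocˡ u b a) (×-congˡ (*-comm b a)))

  pow-ε : ∀ k → pow ε k ≈ ε
  pow-ε k rewrite pow≡× ε k = trans (×-assocˡ ε k 0) (×-congˡ (*-zeroʳ k))

  isPowerOf-refl : ∀ {u} → IsPowerOf u u
  isPowerOf-refl {u} = 1 , sym (identityʳ u)

  isPowerOf-trans : ∀ {u v w} → IsPowerOf u v → IsPowerOf v w → IsPowerOf u w
  isPowerOf-trans {w = w} (k , u≈vᵏ) (m , v≈wᵐ) =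
    m * k , trans u≈vᵏ (trans (pow-cong k v≈wᵐ) (sym (pow-* w m k)))

  isPowerOf-respˡ : ∀ {u u′ v} → u ≈ u′ → IsPowerOf u v → IsPowerOf u′ v
  isPowerOf-respˡ u≈u′ (k , u≈vᵏ) = k , trans (sym u≈u′) u≈vᵏ

  isPowerOf-respʳ : ∀ {u v v′} → v ≈ v′ → IsPowerOf u v → IsPowerOf u v′
  isPowerOf-respʳ v≈v′ (k , u≈vᵏ) = k , trans u≈vᵏ (pow-cong k v≈v′)

  gens-refl : ∀ {u} → gens u u
  gens-refl = isPowerOf-refl , isPowerOf-refl

  ≈⇒isPowerOf : ∀ {u v} → u ≈ v → IsPowerOf u v
  ≈⇒isPowerOf u≈v = isPowerOf-respˡ (sym u≈v) isPowerOf-refl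

  pow≈ε⇒⁻¹-isPowerOf : ∀ {u} m → pow u (suc m) ≈ ε → IsPowerOf (u ⁻¹) u
  pow≈ε⇒⁻¹-isPowerOf {u} m uᵐ⁺¹≈ε = m , sym (inverseʳ-unique u (pow u m) uᵐ⁺¹≈ε)

  ≐-sym : ∀ {ℓ₁ ℓ₂} {S : Carrier → Set ℓ₁} {T : Carrier → Set ℓ₂} → S ≐ T → T ≐ S
  ≐-sym S≐T w = swap (S≐T w)

  ≐-trans : ∀ {ℓ₁ ℓ₂ ℓ₃} {S : Carrier → Set ℓ₁} {T : Carrier → Set ℓ₂} {U : Carrier → Set ℓ₃} →
            S ≐ T → T ≐ U → S ≐ U
  ≐-trans S≐T T≐U w = proj₁ (T≐U w) ∘ proj₁ (S≐T w) , proj₂ (S≐T w) ∘ proj₂ (T≐U w)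

module Cyclic {c ℓ : Level} (G : Group c ℓ) (x : Group.Carrier G) (gen : PowerGraph.Generates G x)
              (n : ℕ) (ord : PowerGraph.IsOrder G x n) where
  open Group G
  open PowerGraph G
  open PowerGraphProperties G
  open import Algebra.Properties.Group G using (∙-cancelˡ; inverseˡ-unique; ⁻¹-involutive)

  instance
    n≢0 : NonZero n
    n≢0 = >-nonZero (proj₁ ord)

  xⁿ≈ε : pow x n ≈ ε
  xⁿ≈ε = proj₁ (proj₂ ord)

  pow-*n≈ε : ∀ q → pow x (q * n) ≈ ε
  pow-*n≈ε q = trans (reflexive (≡.cong (pow x) (*-comm q n)))
               (trans (pow-* x n q) (trans (pow-cong q xⁿ≈ε) (pow-ε q)))

  pow-+*n : ∀ a q → pow x (a + q * n) ≈ pow x a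
  pow-+*n a q = trans (pow-+ x a (q * n)) (trans (∙-congˡ (pow-*n≈ε q)) (identityʳ _))

  pow-% : ∀ a → pow x a ≈ pow x (a % n)
  pow-% a = trans (reflexive (≡.cong (pow x) (m≡m%n+[m/n]*n a n))) (pow-+*n (a % n) (a / n))

  %≡⇒pow≈ : ∀ {a b} → a % n ≡ b % n → pow x a ≈ pow x b
  %≡⇒pow≈ {a} {b} a%n≡b%n =
    trans (pow-% a) (trans (reflexive (≡.cong (pow x) a%n≡b%n)) (sym (pow-% b)))

  pow-injective-< : ∀ {r s} → r ≤ s → s < n → pow x r ≈ pow x s → r ≡ s
  pow-injective-< {r} r≤s s<n xʳ≈xˢ with m≤n⇒∃[o]m+o≡n r≤s
  ... | zero , r+0≡s = ≡.trans (≡.sym (+-identityʳ r)) r+0≡s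
  ... | suc t , ≡.refl =
    contradiction (proj₂ (proj₂ ord) (suc t) z<s xᵗ⁺¹≈ε) (<⇒≱ (≤-<-trans (m≤n+m (suc t) r) s<n))
    where
    xᵗ⁺¹≈ε : pow x (suc t) ≈ ε
    xᵗ⁺¹≈ε = sym (∙-cancelˡ (pow x r) ε (pow x (suc t))
                   (trans (identityʳ _) (trans xʳ≈xˢ (pow-+ x r (suc t)))))

  pow≈⇒%≡ : ∀ {a b} → pow x a ≈ pow x b → a % n ≡ b % n
  pow≈⇒%≡ {a} {b} xᵃ≈xᵇ with ≤-total (a % n) (b % n)
  ... | inj₁ a≤b =
    pow-injective-< a≤b (m%n<n b n) (trans (sym (pow-% a)) (trans xᵃ≈xᵇ (pow-% b)))
  ... | inj₂ b≤a =
    ≡.sym (pow-injective-< b≤a (m%n<n a n) (trans (sym (pow-% b)) (trans (sym xᵃ≈xᵇ) (pow-% a))))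

  pow≈ε⇒∣ : ∀ {a} → pow x a ≈ ε → n ∣ a
  pow≈ε⇒∣ {a} xᵃ≈ε = m%n≡0⇒n∣m a n (≡.trans (pow≈⇒%≡ (trans xᵃ≈ε (sym xⁿ≈ε))) (n%n≡0 n))

  infix 4 _≈?_
  _≈?_ : ∀ u v → Dec (u ≈ v)
  u ≈? v with gen u | gen v
  ... | a , u≈xᵃ | b , v≈xᵇ =
    map′ (λ eq → trans u≈xᵃ (trans (%≡⇒pow≈ eq) (sym v≈xᵇ)))
         (λ u≈v → pow≈⇒%≡ (trans (sym u≈xᵃ) (trans u≈v v≈xᵇ)))
         (a % n ≟ b % n)

  pow-n≈ε : ∀ u → pow u n ≈ ε
  pow-n≈ε u with gen u
  ... | a , u≈xᵃ = trans (pow-cong n u≈xᵃ) (trans (sym (pow-* x a n)) (pow-*n≈ε a))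

  ⁻¹-isPowerOf : ∀ u → IsPowerOf (u ⁻¹) u
  ⁻¹-isPowerOf u =
    pow≈ε⇒⁻¹-isPowerOf (pred n) (trans (reflexive (≡.cong (pow u) (suc-pred n))) (pow-n≈ε u))

  pow-gcd-isPowerOf : ∀ b → IsPowerOf (pow x (gcd b n)) (pow x b)
  pow-gcd-isPowerOf b with Bézout.identity (gcd-GCD b n)
  ... | Bézout.+- u v g+vn≡ub = u , (begin
    pow x (gcd b n)            ≈⟨ pow-+*n (gcd b n) v ⟨
    pow x (gcd b n + v * n)    ≡⟨ ≡.cong (pow x) (≡.trans g+vn≡ub (*-comm u b)) ⟩
    pow x (b * u)              ≈⟨ pow-* x b u ⟩
    pow (pow x b) u            ∎)
    where open import Relation.Binary.Reasoning.Setoid setoid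
  ... | Bézout.-+ u v g+ub≡vn =
    isPowerOf-respˡ (sym xᵍ≈xᵘᵇ⁻¹) (isPowerOf-trans (⁻¹-isPowerOf (pow x (u * b))) xᵘᵇ-isPowerOf)
    where
    xᵍ≈xᵘᵇ⁻¹ : pow x (gcd b n) ≈ pow x (u * b) ⁻¹
    xᵍ≈xᵘᵇ⁻¹ = inverseˡ-unique _ _ (trans (sym (pow-+ x (gcd b n) (u * b)))
                 (trans (reflexive (≡.cong (pow x) g+ub≡vn)) (pow-*n≈ε v)))
    xᵘᵇ-isPowerOf : IsPowerOf (pow x (u * b)) (pow x b)
    xᵘᵇ-isPowerOf = u , trans (reflexive (≡.cong (pow x) (*-comm u b))) (pow-* x b u)

  isPowerOf-pow⇔gcd∣ : ∀ a b → IsPowerOf (pow x a) (pow x b) ⇔ gcd b n ∣ a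
  isPowerOf-pow⇔gcd∣ a b = mk⇔ to′ from′
    where
    to′ : IsPowerOf (pow x a) (pow x b) → gcd b n ∣ a
    to′ (k , xᵃ≈xᵇᵏ) = ∣n∣m%n⇒∣m (gcd[m,n]∣n b n)
      (≡.subst (gcd b n ∣_) (≡.sym (pow≈⇒%≡ (trans xᵃ≈xᵇᵏ (sym (pow-* x b k)))))
        (%-presˡ-∣ (∣-trans (gcd[m,n]∣m b n) (m∣m*n k)) (gcd[m,n]∣n b n)))
    from′ : gcd b n ∣ a → IsPowerOf (pow x a) (pow x b)
    from′ (divides q ≡.refl) =
      isPowerOf-trans (q , trans (reflexive (≡.cong (pow x) (*-comm q (gcd b n)))) (pow-* x (gcd b n) q))
                      (pow-gcd-isPowerOf b)

  index : Carrier → ℕ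
  index u = gcd (proj₁ (gen u)) n

  index∣n : ∀ u → index u ∣ n
  index∣n u = gcd[m,n]∣n (proj₁ (gen u)) n

  isPowerOf⇔index∣ : ∀ {u v} → IsPowerOf u v ⇔ index v ∣ index u
  isPowerOf⇔index∣ {u} {v} with gen u | gen v
  ... | a , u≈xᵃ | b , v≈xᵇ = mk⇔
    (λ u≤v → gcd-greatest
       (to (isPowerOf-pow⇔gcd∣ a b) (isPowerOf-respʳ v≈xᵇ (isPowerOf-respˡ u≈xᵃ u≤v)))
       (gcd[m,n]∣n b n))
    (λ v∣u → isPowerOf-respʳ (sym v≈xᵇ) (isPowerOf-respˡ (sym u≈xᵃ)
             (from (isPowerOf-pow⇔gcd∣ a b) (∣-trans v∣u (gcd[m,n]∣m a n)))))

  gens⇔index≡ : ∀ {u v} → gens v u ⇔ index u ≡ index v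
  gens⇔index≡ = mk⇔
    (λ (u≤v , v≤u) → ∣-antisym (to isPowerOf⇔index∣ v≤u) (to isPowerOf⇔index∣ u≤v))
    (λ u≡v → from isPowerOf⇔index∣ (∣-reflexive (≡.sym u≡v))
           , from isPowerOf⇔index∣ (∣-reflexive u≡v))

  index-cong : ∀ {u v} → u ≈ v → index u ≡ index v
  index-cong u≈v = to gens⇔index≡ (≈⇒isPowerOf u≈v , ≈⇒isPowerOf (sym u≈v))

  index-pow : ∀ a → index (pow x a) ≡ gcd a n
  index-pow a with gen (pow x a)
  ... | b , xᵃ≈xᵇ = ∣-antisym
    (gcd-greatest (to (isPowerOf-pow⇔gcd∣ a b) (≈⇒isPowerOf xᵃ≈xᵇ)) (gcd[m,n]∣n b n))
    (gcd-greatest (to (isPowerOf-pow⇔gcd∣ b a) (≈⇒isPowerOf (sym xᵃ≈xᵇ))) (gcd[m,n]∣n a n))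

  index-ε : index ε ≡ n
  index-ε = ≡.trans (index-pow 0) (gcd-identityˡ n)

  index-x : index x ≡ 1
  index-x = ≡.trans (index-cong (sym (identityʳ x))) (≡.trans (index-pow 1) (gcd-zeroˡ n))

  index-⁻¹ : ∀ u → index (u ⁻¹) ≡ index u
  index-⁻¹ u = to gens⇔index≡
    (⁻¹-isPowerOf u , isPowerOf-respˡ (⁻¹-involutive u) (⁻¹-isPowerOf (u ⁻¹)))

  PowerComparable : Carrier → Carrier → Set ℓ
  PowerComparable u v = IsPowerOf u v ⊎ IsPowerOf v u

  powerComparable⇔comparable : ∀ {u v} → PowerComparable u v ⇔ Comparable (index u) (index v)
  powerComparable⇔comparable = mk⇔
    Sum.[ inj₂ ∘ to isPowerOf⇔index∣ , inj₁ ∘ to isPowerOf⇔index∣ ]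
    Sum.[ inj₂ ∘ from isPowerOf⇔index∣ , inj₁ ∘ from isPowerOf⇔index∣ ]

  N[]⇔powerComparable : ∀ {u v} → N[ u ] v ⇔ PowerComparable u v
  N[]⇔powerComparable {u} {v} = mk⇔ to′ from′
    where
    to′ : N[ u ] v → PowerComparable u v
    to′ (inj₁ (_ , comparable)) = comparable
    to′ (inj₂ v≈u) = inj₂ (≈⇒isPowerOf v≈u)
    from′ : PowerComparable u v → N[ u ] v
    from′ comparable with v ≈? u
    ... | yes v≈u = inj₂ v≈u
    ... | no v≉u = inj₁ ((λ u≈v → v≉u (sym u≈v)) , comparable)

  N[]⇔comparable : ∀ {u v} → N[ u ] v ⇔ Comparable (index u) (index v)
  N[]⇔comparable = ⇔-trans N[]⇔powerComparable powerComparable⇔comparable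

  index≡⇒N[]⊆ : ∀ {u w v} → index u ≡ index w → N[ u ] v → N[ w ] v
  index≡⇒N[]⊆ {v = v} u≡w =
    from N[]⇔comparable ∘ ≡.subst (λ k → Comparable k (index v)) u≡w ∘ to N[]⇔comparable

  index-pow-∣ : ∀ {d} → d ∣ n → index (pow x d) ≡ d
  index-pow-∣ {d} d∣n = ≡.trans (index-pow d) (∣⇒gcd≡ d∣n)

  N[]-pow⇔comparable : ∀ {w d} → d ∣ n → N[ w ] (pow x d) ⇔ Comparable d (index w)
  N[]-pow⇔comparable {w} {d} d∣n =
    ≡.subst (λ k → N[ w ] (pow x d) ⇔ Comparable k (index w)) (index-pow-∣ d∣n)
      (⇔-trans N[]⇔comparable (mk⇔ Sum.swap Sum.swap))

  sameN[]⇒sameComparables : ∀ {u v} → N[ u ] ≐ N[ v ] →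
    ∀ d → d ∣ n → Comparable d (index u) ⇔ Comparable d (index v)
  sameN[]⇒sameComparables N[u]≐N[v] d d∣n = mk⇔
    (to (N[]-pow⇔comparable d∣n) ∘ proj₁ (N[u]≐N[v] (pow x d)) ∘ from (N[]-pow⇔comparable d∣n))
    (to (N[]-pow⇔comparable d∣n) ∘ proj₂ (N[u]≐N[v] (pow x d)) ∘ from (N[]-pow⇔comparable d∣n))

  [e]∪[x]⇔index : ∀ {u} → (gens e ∪ gens x) u ⇔ (index u ≡ n ⊎ index u ≡ 1)
  [e]∪[x]⇔index = mk⇔
    (Sum.map (λ e~u → ≡.trans (to gens⇔index≡ e~u) index-ε)
             (λ x~u → ≡.trans (to gens⇔index≡ x~u) index-x))
    (Sum.map (λ u≡n → from gens⇔index≡ (≡.trans u≡n (≡.sym index-ε)))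
             (λ u≡1 → from gens⇔index≡ (≡.trans u≡1 (≡.sym index-x))))

  [e]∪[x]? : ∀ u → Dec ((gens e ∪ gens x) u)
  [e]∪[x]? u =
    map′ (from [e]∪[x]⇔index) (to [e]∪[x]⇔index) ((index u ≟ n) ⊎-dec (index u ≟ 1))

  gens-respʳ : ∀ {a u v} → u ≈ v → gens a u → gens a v
  gens-respʳ u≈v (u≤a , a≤u) = isPowerOf-respˡ u≈v u≤a , isPowerOf-respʳ u≈v a≤u

  gens-≐ : ∀ {a b} → gens a b → gens b ≐ gens a
  gens-≐ a~b w =
      (λ b~w → from gens⇔index≡ (≡.trans (to gens⇔index≡ b~w) (to gens⇔index≡ a~b)))
    , (λ a~w → from gens⇔index≡ (≡.trans (to gens⇔index≡ a~w) (≡.sym (to gens⇔index≡ a~b))))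

  ≐gens⇒gens : ∀ {S : Subset} {a y} → S ≐ gens y → S ≐ gens a → gens a y
  ≐gens⇒gens {y = y} S≐[y] S≐[a] = proj₁ (S≐[a] y) (proj₂ (S≐[y] y) gens-refl)

  Dominating : Carrier → Set (c ⊔ ℓ)
  Dominating u = ∀ v → N[ u ] v

  [e]∪[x]⇒dominating : ∀ {u} → (gens e ∪ gens x) u → Dominating u
  [e]∪[x]⇒dominating u∈ v with to [e]∪[x]⇔index u∈
  ... | inj₁ u≡n = from N[]⇔comparable (inj₂ (≡.subst (index v ∣_) (≡.sym u≡n) (index∣n v)))
  ... | inj₂ u≡1 = from N[]⇔comparable (inj₁ (≡.subst (_∣ index v) (≡.sym u≡1) (1∣ index v)))

  ∉[e]∪[x]⇒index≢ : ∀ {u} → ¬ (gens e ∪ gens x) u → index u ≢ 1 × index u ≢ n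
  ∉[e]∪[x]⇒index≢ u∉ = (λ u≡1 → u∉ (from [e]∪[x]⇔index (inj₂ u≡1)))
                     , (λ u≡n → u∉ (from [e]∪[x]⇔index (inj₁ u≡n)))

  primePower⇒dominating : IsPrimePower n → ∀ u → Dominating u
  primePower⇒dominating (p , k , pp , n≡pᵏ) u v =
    from N[]⇔comparable (prime^-divisors-comparable pp k (divides-pᵏ u) (divides-pᵏ v))
    where
    divides-pᵏ : ∀ w → index w ∣ p ^ k
    divides-pᵏ w = ≡.subst (index w ∣_) n≡pᵏ (index∣n w)

  nonPrimePower⇒dominating⇒[e]∪[x] : ¬ IsPrimePower n → ∀ {u} →
    Dominating u → (gens e ∪ gens x) u
  nonPrimePower⇒dominating⇒[e]∪[x] ¬ppow {u} dominating with [e]∪[x]? u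
  ... | yes u∈ = u∈
  ... | no u∉ = contradiction
    (λ d d∣n → Sum.swap (to (N[]-pow⇔comparable d∣n) (dominating (pow x d))))
    (uncurry (nonPrimePower⇒incomparable ¬ppow (index∣n u)) (∉[e]∪[x]⇒index≢ u∉))

  selfInverse⇒index : ∀ {u} → u ⁻¹ ≈ u → index u ≡ n ⊎ 2 * index u ≡ n
  selfInverse⇒index {u} u⁻¹≈u with gen u
  ... | a , u≈xᵃ = ∣∧∣2*⇒≡∨2*≡ (gcd[m,n]∣n a n)
    (≡.subst (n ∣_) (≡.sym (c*gcd[m,n]≡gcd[cm,cn] 2 a n))
      (gcd-greatest (pow≈ε⇒∣ {2 * a} x²ᵃ≈ε) (n∣m*n 2)))
    where
    open import Relation.Binary.Reasoning.Setoid setoid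
    x²ᵃ≈ε : pow x (2 * a) ≈ ε
    x²ᵃ≈ε = begin
      pow x (2 * a)        ≡⟨ ≡.cong (λ k → pow x (a + k)) (+-identityʳ a) ⟩
      pow x (a + a)        ≈⟨ pow-+ x a a ⟩
      pow x a ∙ pow x a    ≈⟨ ∙-cong u≈xᵃ u≈xᵃ ⟨
      u ∙ u                ≈⟨ ∙-congˡ u⁻¹≈u ⟨
      u ∙ u ⁻¹             ≈⟨ inverseʳ u ⟩
      ε                    ∎

  N⊆N⇒comparable : ∀ {u w} → ¬ (u ⁻¹ ≈ u) → (∀ v → N u v → N w v) →
    Comparable (index w) (index u)
  N⊆N⇒comparable {u} u⁻¹≉u Nu⊆Nw =
    ≡.subst (Comparable _) (index-⁻¹ u)
      (to powerComparable⇔comparable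
        (proj₂ (Nu⊆Nw (u ⁻¹) ((λ u≈u⁻¹ → u⁻¹≉u (sym u≈u⁻¹)) , inj₂ (⁻¹-isPowerOf u)))))

  sameN⇒≈ : ∀ {u w} → N u ≐ N w → u ≈ w
  sameN⇒≈ {u} {w} Nu≐Nw with u ≈? w
  ... | yes u≈w = u≈w
  ... | no u≉w =
    contradiction refl (proj₁ (proj₁ (Nu≐Nw w) (u≉w , from powerComparable⇔comparable comparable)))
    where
    comparable : Comparable (index u) (index w)
    comparable with w ⁻¹ ≈? w | u ⁻¹ ≈? u
    ... | no w⁻¹≉w | _ = N⊆N⇒comparable w⁻¹≉w (λ v → proj₂ (Nu≐Nw v))
    ... | _ | no u⁻¹≉u = Sum.swap (N⊆N⇒comparable u⁻¹≉u (λ v → proj₁ (Nu≐Nw v)))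
    ... | yes w⁻¹≈w | yes u⁻¹≈u =
      ≡∨2*≡⇒comparable (selfInverse⇒index u⁻¹≈u) (selfInverse⇒index w⁻¹≈w) (index∣n u) (index∣n w)

  class≐Whole : IsPrimePower n → ∀ y → (_≡N y) ≐ Whole
  class≐Whole ppow y w = (λ _ → lift tt)
    , (λ _ → inj₂ λ v → (λ _ → primePower⇒dominating ppow y v)
                      , (λ _ → primePower⇒dominating ppow w v))

  isClass⇔≐Whole : IsPrimePower n → ∀ {S} → IsClass S ⇔ (S ≐ Whole)
  isClass⇔≐Whole ppow = mk⇔ (λ (y , S≐class) → ≐-trans S≐class (class≐Whole ppow y))
                            (λ S≐G → e , ≐-trans S≐G (≐-sym (class≐Whole ppow e)))

  InMergedC′ : Subset → Set (c ⊔ ℓ)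
  InMergedC′ S = (InC' S × ¬ (S ≐ gens e) × ¬ (S ≐ gens x)) ⊎ (S ≐ (gens e ∪ gens x))

  module _ (¬ppow : ¬ IsPrimePower n) where

    class≐[e]∪[x] : ∀ {y} → (gens e ∪ gens x) y → (_≡N y) ≐ (gens e ∪ gens x)
    class≐[e]∪[x] {y} y∈ w = to′ , from′
      where
      to′ : w ≡N y → (gens e ∪ gens x) w
      to′ (inj₁ Nw≐Ny) = Sum.map (gens-respʳ y≈w) (gens-respʳ y≈w) y∈
        where
        y≈w : y ≈ w
        y≈w = sym (sameN⇒≈ Nw≐Ny)
      to′ (inj₂ N[w]≐N[y]) = nonPrimePower⇒dominating⇒[e]∪[x] ¬ppow
        (λ v → proj₂ (N[w]≐N[y] v) ([e]∪[x]⇒dominating y∈ v))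
      from′ : (gens e ∪ gens x) w → w ≡N y
      from′ w∈ = inj₂ λ v → (λ _ → [e]∪[x]⇒dominating y∈ v) , (λ _ → [e]∪[x]⇒dominating w∈ v)

    class≐gens : ∀ {y} → ¬ (gens e ∪ gens x) y → (_≡N y) ≐ gens y
    class≐gens {y} y∉ w = to′ , from′
      where
      to′ : w ≡N y → gens y w
      to′ (inj₁ Nw≐Ny) = gens-respʳ (sym (sameN⇒≈ Nw≐Ny)) gens-refl
      to′ (inj₂ N[w]≐N[y]) = from gens⇔index≡ index-equal
        where
        w∉ : ¬ (gens e ∪ gens x) w
        w∉ w∈ = y∉ (nonPrimePower⇒dominating⇒[e]∪[x] ¬ppow
                      (λ v → proj₁ (N[w]≐N[y] v) ([e]∪[x]⇒dominating w∈ v)))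
        same : ∀ d → d ∣ n → Comparable d (index w) ⇔ Comparable d (index y)
        same = sameN[]⇒sameComparables N[w]≐N[y]
        index-equal : index w ≡ index y
        index-equal with to N[]⇔comparable (proj₂ (N[w]≐N[y] y) (inj₂ refl))
        ... | inj₁ w∣y = sameComparables⇒≡ ¬ppow (index∣n w) (index∣n y) w∣y
                           (proj₁ (∉[e]∪[x]⇒index≢ y∉)) (proj₂ (∉[e]∪[x]⇒index≢ y∉)) same
        ... | inj₂ y∣w = ≡.sym (sameComparables⇒≡ ¬ppow (index∣n y) (index∣n w) y∣w
                           (proj₁ (∉[e]∪[x]⇒index≢ w∉)) (proj₂ (∉[e]∪[x]⇒index≢ w∉))
                           (λ d d∣n → ⇔-sym (same d d∣n)))
      from′ : gens y w → w ≡N y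
      from′ y~w = inj₂ λ v → index≡⇒N[]⊆ w≡y , index≡⇒N[]⊆ (≡.sym w≡y)
        where
        w≡y : index w ≡ index y
        w≡y = to gens⇔index≡ y~w

    isClass⇔InMergedC′ : ∀ {S} → IsClass S ⇔ InMergedC′ S
    isClass⇔InMergedC′ {S} = mk⇔ to′ from′
      where
      to′ : IsClass S → InMergedC′ S
      to′ (y , S≐class) with [e]∪[x]? y
      ... | yes y∈ = inj₂ (≐-trans S≐class (class≐[e]∪[x] y∈))
      ... | no y∉ = let S≐[y] = ≐-trans S≐class (class≐gens y∉) in
        inj₁ ((y , S≐[y]) , y∉ ∘ inj₁ ∘ ≐gens⇒gens S≐[y] , y∉ ∘ inj₂ ∘ ≐gens⇒gens S≐[y])
      from′ : InMergedC′ S → IsClass S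
      from′ (inj₁ ((y , S≐[y]) , S≉[e] , S≉[x])) =
        y , ≐-trans S≐[y] (≐-sym (class≐gens
              Sum.[ S≉[e] ∘ ≐-trans S≐[y] ∘ gens-≐ , S≉[x] ∘ ≐-trans S≐[y] ∘ gens-≐ ]))
      from′ (inj₂ S≐[e]∪[x]) = e , ≐-trans S≐[e]∪[x] (≐-sym (class≐[e]∪[x] (inj₁ gens-refl)))

proposition3p7 : {c ℓ : Level} (G : Group c ℓ) →
    let open PowerGraph G in
    (fin : Finite) (x : Elem) → Generates x → (n : ℕ) → IsOrder x n →
      (IsPrimePower n → ∀ S → (IsClass S → S ≐ Whole) × (S ≐ Whole → IsClass S))
      × (¬ IsPrimePower n → ∀ S →
          (IsClass S →
            ((InC' S × ¬ (S ≐ gens e) × ¬ (S ≐ gens x)) ⊎ (S ≐ (gens e ∪ gens x))))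
          × (((InC' S × ¬ (S ≐ gens e) × ¬ (S ≐ gens x)) ⊎ (S ≐ (gens e ∪ gens x)))
            → IsClass S))
-- Finiteness of G already follows from IsOrder x n.
proposition3p7 G _ x gen n ord =
    (λ ppow S → to (isClass⇔≐Whole ppow) , from (isClass⇔≐Whole ppow))
  , (λ ¬ppow S → to (isClass⇔InMergedC′ ¬ppow) , from (isClass⇔InMergedC′ ¬ppow))
  where open Cyclic G x gen n ord
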